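{- Let $\alpha\in\mathbb Z\setminus\{0,1\}$ and let $(h_n)$ be the sequence with $h_0=0$, $h_1=1$, $h_2=-\alpha^3(\alpha-1)(2\alpha-1)$, $h_3=-\alpha^8(\alpha-1)^3(2\alpha-1)^3$, $h_4=\alpha^{14}(\alpha-1)^6(2\alpha-1)^6$, and for $m\ge2$: $h_{2m+1}=h_{m+2}h_m^3-h_{m-1}h_{m+1}^3$, for $m\ge 3$: $h_{2m}=h_m\big(h_{m+2}h_{m-1}^2-h_{m-2}h_{m+1}^2\big)/h_2$. (i) If $n\equiv 1,4,12,15\pmod{16}$, then $h_n$ is a square. (ii) If $n\equiv 3,13\pmod{16}$, then $h_n$ is a square if and only if $(\alpha-1)(2\alpha-1)$ is a square. (iii) If $n\equiv 5,11\pmod{16}$, then $h_n$ is a square if and only if $\alpha(2\alpha-1)$ is a square.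
   Context: The sequence defined is the elliptic divisibility sequence attached to the point $(0,0)$ of order $8$ on the curve $y^2+(\alpha-\xi)xy-\alpha^3\xi y=x^3-\alpha^2\xi x^2$ with $\xi=(2\alpha-1)(\alpha-1)$ (an integral model of the Tate normal form); its eighth term is zero. Convention: an integer $m$ is called a square if $m=\pm\beta^2$ for some nonzero integer $\beta$, and a cube if $m=\beta^3$ for some nonzero integer $\beta$. -}

module Defs where

open import Data.Nat as ℕ using (ℕ; zero; suc; _∸_)
import Data.Nat.DivMod as ℕD
open import Data.Integer as ℤ using (ℤ; +_; -[1+_]; _-_; _*_; -_; _^_)
open import Data.Product using (∃; _×_)
open import Data.Sum using (_⊎_)
open import Relation.Binary.PropositionalEquality using (_≡_; _≢_)

-- Exact integer division used in the recursion for even indices.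
-- Division by 0 is set to 0; this case never occurs under the theorem's
-- hypotheses (h₂ ≠ 0 when α ∉ {0,1}).
divZ : ℤ → ℤ → ℤ
divZ a (+ zero) = + 0
divZ a b@(+ suc _) = a ℤ./ b
divZ a b@(-[1+ _ ]) = a ℤ./ b

ξ : ℤ → ℤ
ξ α = ((+ 2) * α - + 1) * (α - + 1)

h₂ : ℤ → ℤ
h₂ α = - ((α ^ 3) * ξ α)

h₃ : ℤ → ℤ
h₃ α = - ((α ^ 8) * (ξ α ^ 3))

h₄ : ℤ → ℤ
h₄ α = (α ^ 14) * (ξ α ^ 6)

-- Fuel-based evaluation of the recursion; every recursive call is at a
-- strictly smaller index, so fuel (suc n) suffices to compute h n.
hAux : ℤ → ℕ → ℕ → ℤ
hAux α zero n = + 0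
hAux α (suc f) zero = + 0
hAux α (suc f) (suc zero) = + 1
hAux α (suc f) (suc (suc zero)) = h₂ α
hAux α (suc f) (suc (suc (suc zero))) = h₃ α
hAux α (suc f) (suc (suc (suc (suc zero)))) = h₄ α
hAux α (suc f) n@(suc (suc (suc (suc (suc _))))) with n ℕD.% 2
... | zero =
  divZ (H m * (H (m ℕ.+ 2) * (H (m ∸ 1) ^ 2) - H (m ∸ 2) * (H (m ℕ.+ 1) ^ 2))) (h₂ α)
  where
    H : ℕ → ℤ
    H = hAux α f
    m : ℕ
    m = n ℕD./ 2
... | suc _ =
  H (m ℕ.+ 2) * (H m ^ 3) - H (m ∸ 1) * (H (m ℕ.+ 1) ^ 3)
  where
    H : ℕ → ℤ
    H = hAux α f
    m : ℕ
    m = n ℕD./ 2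

h : ℤ → ℕ → ℤ
h α n = hAux α (suc n) n

-- Paper's convention: m is a square if m = ± β² for some nonzero integer β.
IsSquare : ℤ → Set
IsSquare m = ∃ λ β → β ≢ + 0 × (m ≡ β * β ⊎ m ≡ - (β * β))

module Submission where

open import Defs
open import Data.Nat using (ℕ)
open import Data.Nat.DivMod using (_%_)
open import Data.Integer using (ℤ; +_; _-_; _*_)
open import Data.Product using (_×_)
open import Data.Sum using (_⊎_)
open import Function.Bundles using (_⇔_)
open import Relation.Binary.PropositionalEquality using (_≡_; _≢_)

open import Data.Nat as ℕ using (zero; suc; _∸_)
import Data.Nat.Properties as ℕP
open import Data.Nat.DivMod using (_/_)
import Data.Nat.DivMod as DM
open import Data.Nat.Divisibility using (_∣_; divides; ∣-refl; ∣-trans; m∣m*n; *-cancelʳ-∣)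
open import Data.Nat.GCD using (gcd; gcd[m,n]∣m; gcd[m,n]∣n; gcd[m,n]≢0)
open import Data.Nat.Coprimality using (coprime-divisor; coprime-/gcd)
open import Data.Nat.Induction using (<-rec)
open import Data.Nat.Tactic.RingSolver renaming (solve-∀ to solveℕ-∀)
open import Data.Integer as ℤ using (0ℤ; 1ℤ; -1ℤ; -_; _^_; ∣_∣; -[1+_])
import Data.Integer.Properties as ℤP
import Data.Integer.DivMod as DMℤ
open import Data.Integer.Tactic.RingSolver using (solve-∀)
open import Algebra.Properties.CommutativeSemigroup ℤP.*-commutativeSemigroup using (interchange)
open import Data.Maybe using (Maybe; just; nothing)
open import Data.Product using (∃; _,_; proj₁; proj₂)
open import Data.Sum using (inj₁; inj₂; [_,_]′)
open import Data.Empty using (⊥-elim)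
open import Function.Bundles using (mk⇔; module Equivalence)
open import Function.Properties.Equivalence using () renaming (refl to ⇔-refl; sym to ⇔-sym; trans to ⇔-trans)
open import Relation.Nullary using (yes; no)
open import Relation.Binary.PropositionalEquality
  using (refl; sym; trans; cong; cong₂; subst; subst₂; module ≡-Reasoning)

-- With u = α − 1 and v = 2α − 1, every term h n is 0 or a
-- signed monomial ±αⁱ uʲ vᵏ, and the sequence is quasi-periodic of period 8:
-- h (8 + n) = h n · Aⁿ · B for two fixed monomials A, B with A⁸ = B².
--   * Signed monomials are encoded by exponent vectors (Exponent, Term); the
--     exponent data hExp n of h n is computed by the quasi-periodicity rule
--     from its values for n < 8.
--   * A quasi-periodic sequence satisfies the odd and even recursions of h
--     everywhere once it satisfies them for m = 2, …, 9 (module QuasiPeriodic);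
--     for the monomial sequence c these sixteen identities reduce, after
--     cancelling a common monomial, to α − 1 = u, v − α = u and α² − v = u².
--   * The recursion determines h (h-unique), so h = c.
--   * Shifting by 16 multiplies c by a non-zero square, so whether h n is a
--     square only depends on c (n mod 16) = e · f², i.e. on whether the
--     square-free part e ∈ {1, −1, ±uv, ±αv} is a square (IsSquare-scale).

*-≢0 : ∀ {a b} → a ≢ 0ℤ → b ≢ 0ℤ → a * b ≢ 0ℤ
*-≢0 {a} a≢0 b≢0 ab≡0 with ℤP.i*j≡0⇒i≡0∨j≡0 a ab≡0
... | inj₁ a≡0 = a≢0 a≡0
... | inj₂ b≡0 = b≢0 b≡0

^-≢0 : ∀ {a} n → a ≢ 0ℤ → a ^ n ≢ 0ℤ
^-≢0 {a} n a≢0 aⁿ≡0 = a≢0 (ℤP.i^n≡0⇒i≡0 a n aⁿ≡0)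

*-distribˡ-minus : ∀ g a b → g * a - g * b ≡ g * (a - b)
*-distribˡ-minus = solve-∀

factor-common : ∀ p q t → p * t - q * t ≡ (p - q) * t
factor-common = solve-∀

minus-swap : ∀ a b → b - a ≡ - (a - b)
minus-swap = solve-∀

^-distribʳ-* : ∀ a b n → (a * b) ^ n ≡ a ^ n * b ^ n
^-distribʳ-* a b zero    = refl
^-distribʳ-* a b (suc n) = trans (cong ((a * b) *_) (^-distribʳ-* a b n)) (interchange a b (a ^ n) (b ^ n))

scaled-term : ∀ w r v s k → (w * r) * (v * s) ^ k ≡ (w * v ^ k) * (r * s ^ k)
scaled-term w r v s k = trans (cong ((w * r) *_) (^-distribʳ-* v s k)) (interchange w r (v ^ k) (s ^ k))

-- An exponent vector ⟨ s , i , j , k ⟩ stands for the signed monomial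
-- (−1)ˢ xⁱ yʲ zᵏ in three fixed integers x, y, z.
record Exponent : Set where
  constructor ⟨_,_,_,_⟩
  field
    sign pow₁ pow₂ pow₃ : ℕ

𝟙 −𝟙 x¹ y¹ z¹ : Exponent
𝟙  = ⟨ 0 , 0 , 0 , 0 ⟩
−𝟙 = ⟨ 1 , 0 , 0 , 0 ⟩
x¹ = ⟨ 0 , 1 , 0 , 0 ⟩
y¹ = ⟨ 0 , 0 , 1 , 0 ⟩
z¹ = ⟨ 0 , 0 , 0 , 1 ⟩

infixl 6 _⊕_
infixr 7 _·_
_⊕_ : Exponent → Exponent → Exponent
⟨ s , i , j , k ⟩ ⊕ ⟨ s′ , i′ , j′ , k′ ⟩ = ⟨ s ℕ.+ s′ , i ℕ.+ i′ , j ℕ.+ j′ , k ℕ.+ k′ ⟩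

_·_ : ℕ → Exponent → Exponent
n · ⟨ s , i , j , k ⟩ = ⟨ n ℕ.* s , n ℕ.* i , n ℕ.* j , n ℕ.* k ⟩

-- A term is zero (nothing) or a signed monomial; terms are closed under products.
Term : Set
Term = Maybe Exponent

infixl 6 _⊗_
infixr 8 _⊗^_
_⊗_ : Term → Term → Term
just e ⊗ just f = just (e ⊕ f)
_      ⊗ _      = nothing

_⊗^_ : Term → ℕ → Term
t ⊗^ zero  = just 𝟙
t ⊗^ suc n = t ⊗ t ⊗^ n

module Monomials (x y z : ℤ) where

  ⟦_⟧ : Exponent → ℤ
  ⟦ ⟨ s , i , j , k ⟩ ⟧ = -1ℤ ^ s * (x ^ i * (y ^ j * z ^ k))

  ⟦_⟧ₜ : Term → ℤ
  ⟦ nothing ⟧ₜ = 0ℤ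
  ⟦ just e ⟧ₜ  = ⟦ e ⟧

  ⟦⟧-⊕ : ∀ e f → ⟦ e ⊕ f ⟧ ≡ ⟦ e ⟧ * ⟦ f ⟧
  ⟦⟧-⊕ ⟨ s , i , j , k ⟩ ⟨ s′ , i′ , j′ , k′ ⟩ = begin
    -1ℤ ^ (s ℕ.+ s′) * (x ^ (i ℕ.+ i′) * (y ^ (j ℕ.+ j′) * z ^ (k ℕ.+ k′)))
      ≡⟨ cong₂ _*_ (split -1ℤ s s′) (cong₂ _*_ (split x i i′) (cong₂ _*_ (split y j j′) (split z k k′))) ⟩
    (-1ℤ ^ s * -1ℤ ^ s′) * ((x ^ i * x ^ i′) * ((y ^ j * y ^ j′) * (z ^ k * z ^ k′)))
      ≡⟨ regroup (-1ℤ ^ s) (x ^ i) (y ^ j) (z ^ k) (-1ℤ ^ s′) (x ^ i′) (y ^ j′) (z ^ k′) ⟩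
    (-1ℤ ^ s * (x ^ i * (y ^ j * z ^ k))) * (-1ℤ ^ s′ * (x ^ i′ * (y ^ j′ * z ^ k′))) ∎
    where
    open ≡-Reasoning
    split : ∀ a m n → a ^ (m ℕ.+ n) ≡ a ^ m * a ^ n
    split = ℤP.^-distribˡ-+-*
    regroup : ∀ σ a b c σ′ a′ b′ c′ → (σ * σ′) * ((a * a′) * ((b * b′) * (c * c′)))
                                     ≡ (σ * (a * (b * c))) * (σ′ * (a′ * (b′ * c′)))
    regroup = solve-∀

  ⟦⟧-· : ∀ n e → ⟦ n · e ⟧ ≡ ⟦ e ⟧ ^ n
  ⟦⟧-· zero    e = refl
  ⟦⟧-· (suc n) e = trans (⟦⟧-⊕ e (n · e)) (cong (⟦ e ⟧ *_) (⟦⟧-· n e))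

  ⟦⟧-sq : ∀ e → ⟦ 2 · e ⟧ ≡ ⟦ e ⟧ * ⟦ e ⟧
  ⟦⟧-sq e = trans (⟦⟧-· 2 e) (cong (⟦ e ⟧ *_) (ℤP.*-identityʳ ⟦ e ⟧))

  ⟦⟧-neg : ∀ e → ⟦ −𝟙 ⊕ e ⟧ ≡ - ⟦ e ⟧
  ⟦⟧-neg e = trans (⟦⟧-⊕ −𝟙 e) (ℤP.-1*i≡-i ⟦ e ⟧)

  ⟦⟧-square : ∀ e f → ⟦ e ⊕ 2 · f ⟧ ≡ ⟦ e ⟧ * (⟦ f ⟧ * ⟦ f ⟧)
  ⟦⟧-square e f = trans (⟦⟧-⊕ e (2 · f)) (cong (⟦ e ⟧ *_) (⟦⟧-sq f))

  ⟦x¹⟧ : ⟦ x¹ ⟧ ≡ x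
  ⟦x¹⟧ = trans (ℤP.*-identityˡ _) (trans (ℤP.*-identityʳ _) (ℤP.*-identityʳ x))

  ⟦y¹⟧ : ⟦ y¹ ⟧ ≡ y
  ⟦y¹⟧ = trans (ℤP.*-identityˡ _) (trans (ℤP.*-identityˡ _) (trans (ℤP.*-identityʳ _) (ℤP.*-identityʳ y)))

  ⟦z¹⟧ : ⟦ z¹ ⟧ ≡ z
  ⟦z¹⟧ = trans (ℤP.*-identityˡ _) (trans (ℤP.*-identityˡ _) (trans (ℤP.*-identityˡ _) (ℤP.*-identityʳ z)))

  ⟦⟧-factor : ∀ g a b d → ⟦ a ⟧ - ⟦ b ⟧ ≡ ⟦ d ⟧ → ⟦ g ⊕ a ⟧ - ⟦ g ⊕ b ⟧ ≡ ⟦ g ⊕ d ⟧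
  ⟦⟧-factor g a b d a-b≡d = begin
    ⟦ g ⊕ a ⟧ - ⟦ g ⊕ b ⟧         ≡⟨ cong₂ _-_ (⟦⟧-⊕ g a) (⟦⟧-⊕ g b) ⟩
    ⟦ g ⟧ * ⟦ a ⟧ - ⟦ g ⟧ * ⟦ b ⟧ ≡⟨ *-distribˡ-minus ⟦ g ⟧ ⟦ a ⟧ ⟦ b ⟧ ⟩
    ⟦ g ⟧ * (⟦ a ⟧ - ⟦ b ⟧)       ≡⟨ cong (⟦ g ⟧ *_) a-b≡d ⟩
    ⟦ g ⟧ * ⟦ d ⟧                 ≡⟨ sym (⟦⟧-⊕ g d) ⟩
    ⟦ g ⊕ d ⟧                     ∎
    where open ≡-Reasoning

  ⟦⟧-swap : ∀ a b d → ⟦ a ⟧ - ⟦ b ⟧ ≡ ⟦ d ⟧ → ⟦ b ⟧ - ⟦ a ⟧ ≡ ⟦ −𝟙 ⊕ d ⟧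
  ⟦⟧-swap a b d a-b≡d = begin
    ⟦ b ⟧ - ⟦ a ⟧     ≡⟨ minus-swap ⟦ a ⟧ ⟦ b ⟧ ⟩
    - (⟦ a ⟧ - ⟦ b ⟧) ≡⟨ cong -_ a-b≡d ⟩
    - ⟦ d ⟧           ≡⟨ sym (⟦⟧-neg d) ⟩
    ⟦ −𝟙 ⊕ d ⟧        ∎
    where open ≡-Reasoning

  zero-minus : ∀ e → 0ℤ - ⟦ e ⟧ ≡ ⟦ −𝟙 ⊕ e ⟧
  zero-minus e = trans (ℤP.+-identityˡ (- ⟦ e ⟧)) (sym (⟦⟧-neg e))

  minus-zero : ∀ e → ⟦ e ⟧ - 0ℤ ≡ ⟦ e ⟧
  minus-zero e = ℤP.+-identityʳ ⟦ e ⟧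

  self-minus : ∀ e → ⟦ e ⟧ - ⟦ e ⟧ ≡ 0ℤ
  self-minus e = ℤP.+-inverseʳ ⟦ e ⟧

  ⟦⟧ₜ-⊗ : ∀ s t → ⟦ s ⊗ t ⟧ₜ ≡ ⟦ s ⟧ₜ * ⟦ t ⟧ₜ
  ⟦⟧ₜ-⊗ (just e) (just f) = ⟦⟧-⊕ e f
  ⟦⟧ₜ-⊗ (just e) nothing  = sym (ℤP.*-zeroʳ ⟦ e ⟧)
  ⟦⟧ₜ-⊗ nothing  t        = refl

  ⟦⟧ₜ-⊗^ : ∀ t n → ⟦ t ⊗^ n ⟧ₜ ≡ ⟦ t ⟧ₜ ^ n
  ⟦⟧ₜ-⊗^ t zero    = refl
  ⟦⟧ₜ-⊗^ t (suc n) = trans (⟦⟧ₜ-⊗ t (t ⊗^ n)) (cong (⟦ t ⟧ₜ *_) (⟦⟧ₜ-⊗^ t n))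

  ⟦⟧ₜ-term : ∀ s t k → ⟦ s ⟧ₜ * ⟦ t ⟧ₜ ^ k ≡ ⟦ s ⊗ t ⊗^ k ⟧ₜ
  ⟦⟧ₜ-term s t k = sym (trans (⟦⟧ₜ-⊗ s (t ⊗^ k)) (cong (⟦ s ⟧ₜ *_) (⟦⟧ₜ-⊗^ t k)))

  ⟦⟧≢0 : x ≢ 0ℤ → y ≢ 0ℤ → z ≢ 0ℤ → ∀ e → ⟦ e ⟧ ≢ 0ℤ
  ⟦⟧≢0 x≢0 y≢0 z≢0 ⟨ s , i , j , k ⟩ =
    *-≢0 (^-≢0 s (λ ())) (*-≢0 (^-≢0 i x≢0) (*-≢0 (^-≢0 j y≢0) (^-≢0 k z≢0)))

oddExpr : (ℕ → ℤ) → ℕ → ℤ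
oddExpr W m = W (m ℕ.+ 2) * W m ^ 3 - W (m ∸ 1) * W (m ℕ.+ 1) ^ 3

evenExpr : (ℕ → ℤ) → ℕ → ℤ
evenExpr W m = W m * (W (m ℕ.+ 2) * W (m ∸ 1) ^ 2 - W (m ∸ 2) * W (m ℕ.+ 1) ^ 2)

OddStep : (ℕ → ℤ) → ℕ → Set
OddStep W m = oddExpr W m ≡ W (1 ℕ.+ m ℕ.* 2)

EvenStep : ℤ → (ℕ → ℤ) → ℕ → Set
EvenStep d W m = evenExpr W m ≡ d * W (m ℕ.* 2)

module _ {H W : ℕ → ℤ} (m : ℕ) (agree : ∀ i → i ℕ.≤ m ℕ.+ 2 → H i ≡ W i) where
  private
    m≤ : m ℕ.≤ m ℕ.+ 2
    m≤ = ℕP.m≤m+n m 2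
    m+1≤ : m ℕ.+ 1 ℕ.≤ m ℕ.+ 2
    m+1≤ = ℕP.+-monoʳ-≤ m (ℕP.n≤1+n 1)
    m∸≤ : ∀ k → m ∸ k ℕ.≤ m ℕ.+ 2
    m∸≤ k = ℕP.≤-trans (ℕP.m∸n≤m m k) m≤

  oddExpr-cong : oddExpr H m ≡ oddExpr W m
  oddExpr-cong = cong₂ _-_
    (cong₂ (λ a b → a * b ^ 3) (agree (m ℕ.+ 2) ℕP.≤-refl) (agree m m≤))
    (cong₂ (λ a b → a * b ^ 3) (agree (m ∸ 1) (m∸≤ 1)) (agree (m ℕ.+ 1) m+1≤))

  evenExpr-cong : evenExpr H m ≡ evenExpr W m
  evenExpr-cong = cong₂ _*_ (agree m m≤) (cong₂ _-_
    (cong₂ (λ a b → a * b ^ 2) (agree (m ℕ.+ 2) ℕP.≤-refl) (agree (m ∸ 1) (m∸≤ 1)))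
    (cong₂ (λ a b → a * b ^ 2) (agree (m ∸ 2) (m∸≤ 2)) (agree (m ℕ.+ 1) m+1≤)))

residue-induction : ∀ N .{{_ : ℕ.NonZero N}} (P : ℕ → Set) →
  (∀ i → P i → P (N ℕ.+ i)) → (∀ s → s ℕ.< N → P s) → ∀ j → P j
residue-induction N P up base = <-rec P step
  where
  step : ∀ j → (∀ {i} → i ℕ.< j → P i) → P j
  step j below with j ℕ.<? N
  ... | yes j<N = base j j<N
  ... | no j≮N with ℕP.m≤n⇒∃[o]m+o≡n (ℕP.≮⇒≥ j≮N)
  ...   | i , refl = up i (below (ℕP.m<n+m i (ℕ.>-nonZero⁻¹ N)))

-- A quasi-periodic sequence, W (N + n) = W n · Aⁿ · B with Aᴺ = B², satisfies
-- the two recursions everywhere as soon as it satisfies them at N consecutive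
-- indices, and W (2N + n) is W n times a square.
module QuasiPeriodic (N : ℕ) .{{_ : ℕ.NonZero N}} (A B : ℤ) (W : ℕ → ℤ)
  (shift : ∀ n → W (N ℕ.+ n) ≡ W n * (A ^ n * B)) (period : A ^ N ≡ B ^ 2) where

  S : ℕ → ℤ
  S n = A ^ n * B

  shift-at : ∀ {n′} n → n′ ≡ N ℕ.+ n → W n′ ≡ W n * S n
  shift-at n refl = shift n

  S-absorb : ∀ p e k → S p * (A ^ e * B ^ k) ≡ A ^ (p ℕ.+ e) * B ^ suc k
  S-absorb p e k = trans (interchange (A ^ p) B (A ^ e) (B ^ k)) (cong (_* B ^ suc k) (sym (ℤP.^-distribˡ-+-* A p e)))

  S-weight : ∀ p q k → S p * S q ^ k ≡ A ^ (p ℕ.+ q ℕ.* k) * B ^ suc k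
  S-weight p q k = begin
    S p * S q ^ k                   ≡⟨ cong (S p *_) (^-distribʳ-* (A ^ q) B k) ⟩
    S p * ((A ^ q) ^ k * B ^ k)     ≡⟨ cong (λ a → S p * (a * B ^ k)) (ℤP.^-*-assoc A q k) ⟩
    S p * (A ^ (q ℕ.* k) * B ^ k)   ≡⟨ S-absorb p (q ℕ.* k) k ⟩
    A ^ (p ℕ.+ q ℕ.* k) * B ^ suc k ∎
    where open ≡-Reasoning

  S-period : ∀ q → S (N ℕ.+ q) ≡ A ^ q * B ^ 3
  S-period q = begin
    A ^ (N ℕ.+ q) * B       ≡⟨ cong (_* B) (ℤP.^-distribˡ-+-* A N q) ⟩
    (A ^ N * A ^ q) * B     ≡⟨ cong (λ a → (a * A ^ q) * B) period ⟩
    (B ^ 2 * A ^ q) * B     ≡⟨ rotate (B ^ 2) (A ^ q) B ⟩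
    A ^ q * (B * B ^ 2)     ∎
    where
    open ≡-Reasoning
    rotate : ∀ c a b → (c * a) * b ≡ a * (b * c)
    rotate = solve-∀

  double-shift : ∀ q → W (N ℕ.+ (N ℕ.+ q)) ≡ W q * (A ^ (q ℕ.+ q) * B ^ 4)
  double-shift q = begin
    W (N ℕ.+ (N ℕ.+ q))           ≡⟨ shift (N ℕ.+ q) ⟩
    W (N ℕ.+ q) * S (N ℕ.+ q)     ≡⟨ cong₂ _*_ (shift q) (S-period q) ⟩
    (W q * S q) * (A ^ q * B ^ 3) ≡⟨ ℤP.*-assoc (W q) (S q) _ ⟩
    W q * (S q * (A ^ q * B ^ 3)) ≡⟨ cong (W q *_) (S-absorb q q 3) ⟩
    W q * (A ^ (q ℕ.+ q) * B ^ 4) ∎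
    where open ≡-Reasoning

  square-shift : ∀ n → W (N ℕ.+ (N ℕ.+ n)) ≡ W n * ((A ^ n * B ^ 2) * (A ^ n * B ^ 2))
  square-shift n = trans (double-shift n)
    (cong (W n *_) (trans (cong (_* B ^ 4) (ℤP.^-distribˡ-+-* A n n))
                          (trans (cong (A ^ n * A ^ n *_) (ℤP.^-distribˡ-+-* B 2 2))
                                 (interchange (A ^ n) (A ^ n) (B ^ 2) (B ^ 2)))))

  -- Both sides of the odd recursion at m + N are those at m times A^(4m+2) B⁴.
  oddStep-shift : ∀ j → OddStep W (suc j) → OddStep W (N ℕ.+ suc j)
  oddStep-shift j step = begin
    W (N ℕ.+ m ℕ.+ 2) * W (N ℕ.+ m) ^ 3 - W (N ℕ.+ m ∸ 1) * W (N ℕ.+ m ℕ.+ 1) ^ 3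
      ≡⟨ cong₂ _-_ (cong₂ (λ a b → a * b ^ 3) (shift-at (m ℕ.+ 2) (ℕP.+-assoc N m 2)) (shift m))
                   (cong₂ (λ a b → a * b ^ 3) (shift-at j (cong (_∸ 1) (ℕP.+-suc N j))) (shift-at (m ℕ.+ 1) (ℕP.+-assoc N m 1))) ⟩
    (W (m ℕ.+ 2) * S (m ℕ.+ 2)) * (W m * S m) ^ 3 - (W j * S j) * (W (m ℕ.+ 1) * S (m ℕ.+ 1)) ^ 3
      ≡⟨ cong₂ _-_ (scaled-term (W (m ℕ.+ 2)) (S (m ℕ.+ 2)) (W m) (S m) 3) (scaled-term (W j) (S j) (W (m ℕ.+ 1)) (S (m ℕ.+ 1)) 3) ⟩
    X * (S (m ℕ.+ 2) * S m ^ 3) - Y * (S j * S (m ℕ.+ 1) ^ 3)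
      ≡⟨ cong₂ (λ s t → X * s - Y * t) (trans (S-weight (m ℕ.+ 2) m 3) (cong (λ e → A ^ e * B ^ 4) (exp₁ j)))
                                        (trans (S-weight j (m ℕ.+ 1) 3) (cong (λ e → A ^ e * B ^ 4) (exp₂ j))) ⟩
    X * T - Y * T  ≡⟨ factor-common X Y T ⟩
    (X - Y) * T    ≡⟨ cong (_* T) step ⟩
    W q * T        ≡⟨ sym (double-shift q) ⟩
    W (N ℕ.+ (N ℕ.+ q)) ≡⟨ cong W (index N j) ⟩
    W (1 ℕ.+ (N ℕ.+ m) ℕ.* 2) ∎
    where
    open ≡-Reasoning
    m q : ℕ
    m = suc j
    q = 1 ℕ.+ m ℕ.* 2
    X Y T : ℤ
    X = W (m ℕ.+ 2) * W m ^ 3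
    Y = W j * W (m ℕ.+ 1) ^ 3
    T = A ^ (q ℕ.+ q) * B ^ 4
    exp₁ : ∀ j → suc j ℕ.+ 2 ℕ.+ suc j ℕ.* 3 ≡ (1 ℕ.+ suc j ℕ.* 2) ℕ.+ (1 ℕ.+ suc j ℕ.* 2)
    exp₁ = solveℕ-∀
    exp₂ : ∀ j → j ℕ.+ (suc j ℕ.+ 1) ℕ.* 3 ≡ (1 ℕ.+ suc j ℕ.* 2) ℕ.+ (1 ℕ.+ suc j ℕ.* 2)
    exp₂ = solveℕ-∀
    index : ∀ N j → N ℕ.+ (N ℕ.+ (1 ℕ.+ suc j ℕ.* 2)) ≡ 1 ℕ.+ (N ℕ.+ suc j) ℕ.* 2
    index = solveℕ-∀

  -- Both sides of the even recursion at m + N are those at m times A^(4m) B⁴.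
  evenStep-shift : ∀ d j → EvenStep d W (suc (suc j)) → EvenStep d W (N ℕ.+ suc (suc j))
  evenStep-shift d j step = begin
    W (N ℕ.+ m) * (W (N ℕ.+ m ℕ.+ 2) * W (N ℕ.+ m ∸ 1) ^ 2 - W (N ℕ.+ m ∸ 2) * W (N ℕ.+ m ℕ.+ 1) ^ 2)
      ≡⟨ cong₂ _*_ (shift m)
           (cong₂ _-_ (cong₂ (λ a b → a * b ^ 2) (shift-at (m ℕ.+ 2) (ℕP.+-assoc N m 2)) (shift-at (suc j) m∸1))
                      (cong₂ (λ a b → a * b ^ 2) (shift-at j m∸2) (shift-at (m ℕ.+ 1) (ℕP.+-assoc N m 1)))) ⟩
    (W m * S m) * ((W (m ℕ.+ 2) * S (m ℕ.+ 2)) * (W (suc j) * S (suc j)) ^ 2 - (W j * S j) * (W (m ℕ.+ 1) * S (m ℕ.+ 1)) ^ 2)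
      ≡⟨ cong ((W m * S m) *_) (cong₂ _-_ (scaled-term (W (m ℕ.+ 2)) (S (m ℕ.+ 2)) (W (suc j)) (S (suc j)) 2)
                                           (scaled-term (W j) (S j) (W (m ℕ.+ 1)) (S (m ℕ.+ 1)) 2)) ⟩
    (W m * S m) * (X * (S (m ℕ.+ 2) * S (suc j) ^ 2) - Y * (S j * S (m ℕ.+ 1) ^ 2))
      ≡⟨ cong ((W m * S m) *_) (cong₂ (λ s t → X * s - Y * t) (S-weight (m ℕ.+ 2) (suc j) 2)
                                  (trans (S-weight j (m ℕ.+ 1) 2) (cong (λ e → A ^ e * B ^ 3) (exp₁ j)))) ⟩
    (W m * S m) * (X * T - Y * T)     ≡⟨ cong ((W m * S m) *_) (factor-common X Y T) ⟩
    (W m * S m) * ((X - Y) * T)       ≡⟨ interchange (W m) (S m) (X - Y) T ⟩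
    (W m * (X - Y)) * (S m * T)       ≡⟨ cong₂ _*_ step (trans (S-absorb m _ 3) (cong (λ e → A ^ e * B ^ 4) (exp₂ j))) ⟩
    (d * W q) * (A ^ (q ℕ.+ q) * B ^ 4) ≡⟨ ℤP.*-assoc d (W q) _ ⟩
    d * (W q * (A ^ (q ℕ.+ q) * B ^ 4)) ≡⟨ cong (d *_) (sym (double-shift q)) ⟩
    d * W (N ℕ.+ (N ℕ.+ q))           ≡⟨ cong (λ i → d * W i) (index N j) ⟩
    d * W ((N ℕ.+ m) ℕ.* 2)           ∎
    where
    open ≡-Reasoning
    m q : ℕ
    m = suc (suc j)
    q = m ℕ.* 2
    X Y T : ℤ
    X = W (m ℕ.+ 2) * W (suc j) ^ 2
    Y = W j * W (m ℕ.+ 1) ^ 2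
    T = A ^ (m ℕ.+ 2 ℕ.+ suc j ℕ.* 2) * B ^ 3
    m∸1 : N ℕ.+ m ∸ 1 ≡ N ℕ.+ suc j
    m∸1 = cong (_∸ 1) (ℕP.+-suc N (suc j))
    m∸2 : N ℕ.+ m ∸ 2 ≡ N ℕ.+ j
    m∸2 = trans (cong (_∸ 2) (ℕP.+-suc N (suc j))) (cong (_∸ 1) (ℕP.+-suc N j))
    exp₁ : ∀ j → j ℕ.+ (suc (suc j) ℕ.+ 1) ℕ.* 2 ≡ suc (suc j) ℕ.+ 2 ℕ.+ suc j ℕ.* 2
    exp₁ = solveℕ-∀
    exp₂ : ∀ j → suc (suc j) ℕ.+ (suc (suc j) ℕ.+ 2 ℕ.+ suc j ℕ.* 2) ≡ suc (suc j) ℕ.* 2 ℕ.+ suc (suc j) ℕ.* 2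
    exp₂ = solveℕ-∀
    index : ∀ N j → N ℕ.+ (N ℕ.+ suc (suc j) ℕ.* 2) ≡ (N ℕ.+ suc (suc j)) ℕ.* 2
    index = solveℕ-∀

  two+ : ∀ i → N ℕ.+ suc (suc i) ≡ 2 ℕ.+ (N ℕ.+ i)
  two+ i = trans (ℕP.+-suc N (suc i)) (cong suc (ℕP.+-suc N i))

  oddStep-everywhere : (∀ s → s ℕ.< N → OddStep W (2 ℕ.+ s)) → ∀ j → OddStep W (2 ℕ.+ j)
  oddStep-everywhere = residue-induction N (λ j → OddStep W (2 ℕ.+ j))
    (λ i step → subst (OddStep W) (two+ i) (oddStep-shift (suc i) step))

  evenStep-everywhere : ∀ d → (∀ s → s ℕ.< N → EvenStep d W (2 ℕ.+ s)) → ∀ j → EvenStep d W (2 ℕ.+ j)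
  evenStep-everywhere d = residue-induction N (λ j → EvenStep d W (2 ℕ.+ j))
    (λ i step → subst (EvenStep d W) (two+ i) (evenStep-shift d i step))

/-cancel : ∀ b y .{{_ : ℤ.NonZero b}} → (b * y) ℤ./ b ≡ y
/-cancel b y = sym (ℤP.i-j≡0⇒i≡j y q (ℤP.∣i∣≡0⇒i≡0 (ℕP.n<1⇒n≡0 ∣y-q∣<1)))
  where
  q : ℤ
  q = (b * y) ℤ./ b
  -- the remainder of b · y is b · (y − q), and it is smaller than ∣ b ∣
  remainder : + ((b * y) ℤ.% b) ≡ b * (y - q)
  remainder = begin
    + ((b * y) ℤ.% b)                    ≡⟨ move (b * y) _ (q * b) (DMℤ.a≡a%n+[a/n]*n (b * y) b) ⟩
    b * y - q * b                        ≡⟨ cong (λ t → b * y - t) (ℤP.*-comm q b) ⟩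
    b * y - b * q                        ≡⟨ *-distribˡ-minus b y q ⟩
    b * (y - q)                          ∎
    where
    open ≡-Reasoning
    add-sub : ∀ r t → r ≡ (r ℤ.+ t) - t
    add-sub = solve-∀
    move : ∀ a r t → a ≡ r ℤ.+ t → r ≡ a - t
    move a r t a≡r+t = trans (add-sub r t) (cong (_- t) (sym a≡r+t))
  ∣y-q∣<1 : ∣ y - q ∣ ℕ.< 1
  ∣y-q∣<1 = ℕP.*-cancelˡ-< ∣ b ∣ ∣ y - q ∣ 1
    (subst₂ ℕ._<_ (trans (cong ∣_∣ remainder) (ℤP.abs-* b (y - q))) (sym (ℕP.*-identityʳ ∣ b ∣))
            (DMℤ.n%d<d (b * y) b))

divZ-cancel : ∀ b y → b ≢ 0ℤ → divZ (b * y) b ≡ y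
divZ-cancel (+ zero)     y b≢0 = ⊥-elim (b≢0 refl)
divZ-cancel b@(+ suc _)  y _   = /-cancel b y
divZ-cancel b@(-[1+ _ ]) y _   = /-cancel b y

hAux-unfold : ∀ α f x → let n = 5 ℕ.+ x ; m = n / 2 ; H = hAux α f in
    (n ≡ m ℕ.* 2 × hAux α (suc f) n ≡ divZ (H m * (H (m ℕ.+ 2) * H (m ∸ 1) ^ 2 - H (m ∸ 2) * H (m ℕ.+ 1) ^ 2)) (h₂ α))
  ⊎ (n ≡ 1 ℕ.+ m ℕ.* 2 × hAux α (suc f) n ≡ H (m ℕ.+ 2) * H m ^ 3 - H (m ∸ 1) * H (m ℕ.+ 1) ^ 3)
hAux-unfold α f x with (5 ℕ.+ x) % 2 | DM.m≡m%n+[m/n]*n (5 ℕ.+ x) 2 | DM.m%n<n (5 ℕ.+ x) 2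
... | 0           | n≡2m   | _ = inj₁ (n≡2m , refl)
... | 1           | n≡2m+1 | _ = inj₂ (n≡2m+1 , refl)
... | suc (suc _) | _      | ℕ.s≤s (ℕ.s≤s ())

agree-large : ∀ α (W : ℕ → ℤ) → h₂ α ≢ 0ℤ →
  (∀ j → OddStep W (2 ℕ.+ j)) → (∀ j → EvenStep (h₂ α) W (2 ℕ.+ j)) →
  ∀ f → (∀ i → i ℕ.< f → hAux α f i ≡ W i) → ∀ x → 5 ℕ.+ x ℕ.≤ f → hAux α (suc f) (5 ℕ.+ x) ≡ W (5 ℕ.+ x)
agree-large α W h₂≢0 odd even f ih x n≤f = [ even-case , odd-case ]′ (hAux-unfold α f x)
  where
  open ≡-Reasoning
  n m : ℕ
  n = 5 ℕ.+ x
  m = n / 2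
  H : ℕ → ℤ
  H = hAux α f

  below : m ℕ.+ 2 ℕ.< n → ∀ i → i ℕ.≤ m ℕ.+ 2 → H i ≡ W i
  below m+2<n i i≤m+2 = ih i (ℕP.<-≤-trans (ℕP.≤-<-trans i≤m+2 m+2<n) n≤f)

  odd-index : ∀ m → n ≡ 1 ℕ.+ m ℕ.* 2 → OddStep W m × m ℕ.+ 2 ℕ.< n
  odd-index (suc (suc j)) e = odd j , subst (suc (suc (suc j)) ℕ.+ 2 ℕ.≤_) (sym e) (bound j)
    where
    arith : ∀ j → suc (suc (suc j)) ℕ.+ 2 ℕ.+ j ≡ 1 ℕ.+ suc (suc j) ℕ.* 2
    arith = solveℕ-∀
    bound : ∀ j → suc (suc (suc j)) ℕ.+ 2 ℕ.≤ 1 ℕ.+ suc (suc j) ℕ.* 2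
    bound j = ℕP.≤-trans (ℕP.m≤m+n _ j) (ℕP.≤-reflexive (arith j))

  even-index : ∀ m → n ≡ m ℕ.* 2 → EvenStep (h₂ α) W m × m ℕ.+ 2 ℕ.< n
  even-index (suc (suc (suc j))) e = even (suc j) , subst (suc (suc (suc (suc j))) ℕ.+ 2 ℕ.≤_) (sym e) (bound j)
    where
    arith : ∀ j → suc (suc (suc (suc j))) ℕ.+ 2 ℕ.+ j ≡ suc (suc (suc j)) ℕ.* 2
    arith = solveℕ-∀
    bound : ∀ j → suc (suc (suc (suc j))) ℕ.+ 2 ℕ.≤ suc (suc (suc j)) ℕ.* 2
    bound j = ℕP.≤-trans (ℕP.m≤m+n _ j) (ℕP.≤-reflexive (arith j))

  even-case : n ≡ m ℕ.* 2 × hAux α (suc f) n ≡ divZ (evenExpr H m) (h₂ α) → hAux α (suc f) n ≡ W n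
  even-case (n≡2m , unfolded) = begin
    hAux α (suc f) n                 ≡⟨ unfolded ⟩
    divZ (evenExpr H m) (h₂ α)       ≡⟨ cong (λ t → divZ t (h₂ α)) (evenExpr-cong {H} {W} m (below m+2<n)) ⟩
    divZ (evenExpr W m) (h₂ α)       ≡⟨ cong (λ t → divZ t (h₂ α)) step ⟩
    divZ (h₂ α * W (m ℕ.* 2)) (h₂ α) ≡⟨ divZ-cancel (h₂ α) (W (m ℕ.* 2)) h₂≢0 ⟩
    W (m ℕ.* 2)                      ≡⟨ cong W (sym n≡2m) ⟩
    W n                              ∎
    where
    step : EvenStep (h₂ α) W m
    step = proj₁ (even-index m n≡2m)
    m+2<n : m ℕ.+ 2 ℕ.< n
    m+2<n = proj₂ (even-index m n≡2m)

  odd-case : n ≡ 1 ℕ.+ m ℕ.* 2 × hAux α (suc f) n ≡ oddExpr H m → hAux α (suc f) n ≡ W n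
  odd-case (n≡2m+1 , unfolded) = begin
    hAux α (suc f) n   ≡⟨ unfolded ⟩
    oddExpr H m        ≡⟨ oddExpr-cong {H} {W} m (below m+2<n) ⟩
    oddExpr W m        ≡⟨ step ⟩
    W (1 ℕ.+ m ℕ.* 2)  ≡⟨ cong W (sym n≡2m+1) ⟩
    W n                ∎
    where
    step : OddStep W m
    step = proj₁ (odd-index m n≡2m+1)
    m+2<n : m ℕ.+ 2 ℕ.< n
    m+2<n = proj₂ (odd-index m n≡2m+1)

h-unique : ∀ α (W : ℕ → ℤ) → h₂ α ≢ 0ℤ →
  W 0 ≡ 0ℤ → W 1 ≡ 1ℤ → W 2 ≡ h₂ α → W 3 ≡ h₃ α → W 4 ≡ h₄ α →
  (∀ j → OddStep W (2 ℕ.+ j)) → (∀ j → EvenStep (h₂ α) W (2 ℕ.+ j)) →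
  ∀ n → h α n ≡ W n
h-unique α W h₂≢0 W₀ W₁ W₂ W₃ W₄ odd even n = agree (suc n) n ℕP.≤-refl
  where
  agree : ∀ f n → n ℕ.< f → hAux α f n ≡ W n
  agree zero    _ ()
  agree (suc f) 0 _ = sym W₀
  agree (suc f) 1 _ = sym W₁
  agree (suc f) 2 _ = sym W₂
  agree (suc f) 3 _ = sym W₃
  agree (suc f) 4 _ = sym W₄
  agree (suc f) (suc (suc (suc (suc (suc x))))) (ℕ.s≤s n≤f) = agree-large α W h₂≢0 odd even f (agree f) x n≤f

IsSquareℕ : ℕ → Set
IsSquareℕ n = ∃ λ k → k ≢ 0 × n ≡ k ℕ.* k

IsSquare⇔abs : ∀ Y → IsSquare Y ⇔ IsSquareℕ ∣ Y ∣
IsSquare⇔abs Y = mk⇔ to (from Y)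
  where
  to : IsSquare Y → IsSquareℕ ∣ Y ∣
  to (β , β≢0 , inj₁ Y≡ββ)  = ∣ β ∣ , (λ ∣β∣≡0 → β≢0 (ℤP.∣i∣≡0⇒i≡0 ∣β∣≡0)) ,
    trans (cong ∣_∣ Y≡ββ) (ℤP.abs-* β β)
  to (β , β≢0 , inj₂ Y≡-ββ) = ∣ β ∣ , (λ ∣β∣≡0 → β≢0 (ℤP.∣i∣≡0⇒i≡0 ∣β∣≡0)) ,
    trans (cong ∣_∣ Y≡-ββ) (trans (ℤP.∣-i∣≡∣i∣ (β * β)) (ℤP.abs-* β β))
  from : ∀ Y → IsSquareℕ ∣ Y ∣ → IsSquare Y
  from (+ y)      (k , k≢0 , y≡kk) = + k , (λ { refl → k≢0 refl }) , inj₁ (trans (cong +_ y≡kk) (ℤP.pos-* k k))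
  from -[1+ y ]   (k , k≢0 , y≡kk) = + k , (λ { refl → k≢0 refl }) , inj₂ (cong -_ (trans (cong +_ y≡kk) (ℤP.pos-* k k)))

IsSquareℕ-cong : ∀ {m n} → m ≡ n → IsSquareℕ m ⇔ IsSquareℕ n
IsSquareℕ-cong refl = ⇔-refl

IsSquare-cong : ∀ {Y Y′} → Y ≡ Y′ → IsSquare Y ⇔ IsSquare Y′
IsSquare-cong refl = ⇔-refl

IsSquare-one : IsSquare 1ℤ
IsSquare-one = 1ℤ , (λ ()) , inj₁ refl

IsSquare-minus-one : IsSquare (- 1ℤ)
IsSquare-minus-one = 1ℤ , (λ ()) , inj₂ refl

IsSquare-neg : ∀ Y → IsSquare (- Y) ⇔ IsSquare Y
IsSquare-neg Y = ⇔-trans (IsSquare⇔abs (- Y))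
  (⇔-trans (IsSquareℕ-cong (ℤP.∣-i∣≡∣i∣ Y)) (⇔-sym (IsSquare⇔abs Y)))

-- In ℕ, a² ∣ b² implies a ∣ b: with g = gcd a b, a = a′g and b = b′g with
-- a′, b′ coprime, and a′ ∣ b′² forces a′ ∣ b′, hence a′ = 1.
square-∣ : ∀ a b → a ≢ 0 → a ℕ.* a ∣ b ℕ.* b → a ∣ b
square-∣ a b a≢0 a²∣b² = subst (_∣ b) g≡a (gcd[m,n]∣n a b)
  where
  g : ℕ
  g = gcd a b
  instance
    g≢0 : ℕ.NonZero g
    g≢0 = ℕ.≢-nonZero (gcd[m,n]≢0 a b (inj₁ a≢0))
    g²≢0 : ℕ.NonZero (g ℕ.* g)
    g²≢0 = ℕP.m*n≢0 g g
  a′ b′ : ℕ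
  a′ = a / g
  b′ = b / g
  square-of : ∀ p {q} → p ℕ.* g ≡ q → q ℕ.* q ≡ (p ℕ.* p) ℕ.* (g ℕ.* g)
  square-of p refl = regroup p g
    where
    regroup : ∀ p g → (p ℕ.* g) ℕ.* (p ℕ.* g) ≡ (p ℕ.* p) ℕ.* (g ℕ.* g)
    regroup = solveℕ-∀
  a′g≡a : a′ ℕ.* g ≡ a
  a′g≡a = DM.m/n*n≡m (gcd[m,n]∣m a b)
  a′²∣b′² : a′ ℕ.* a′ ∣ b′ ℕ.* b′
  a′²∣b′² = *-cancelʳ-∣ (g ℕ.* g)
    (subst₂ _∣_ (square-of a′ a′g≡a) (square-of b′ (DM.m/n*n≡m (gcd[m,n]∣n a b))) a²∣b²)
  a′∣b′ : a′ ∣ b′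
  a′∣b′ = coprime-divisor (coprime-/gcd a b) (∣-trans (m∣m*n a′) a′²∣b′²)
  g≡a : g ≡ a
  g≡a = trans (sym (ℕP.*-identityˡ g)) (trans (cong (ℕ._* g) (sym (coprime-/gcd a b (∣-refl , a′∣b′)))) a′g≡a)

IsSquareℕ-scale : ∀ n v → v ≢ 0 → IsSquareℕ (n ℕ.* (v ℕ.* v)) ⇔ IsSquareℕ n
IsSquareℕ-scale n v v≢0 = mk⇔ to from
  where
  instance
    v²≢0 : ℕ.NonZero (v ℕ.* v)
    v²≢0 = ℕP.m*n≢0 v v {{ℕ.≢-nonZero v≢0}} {{ℕ.≢-nonZero v≢0}}
  regroup : ∀ k v → (k ℕ.* v) ℕ.* (k ℕ.* v) ≡ (k ℕ.* k) ℕ.* (v ℕ.* v)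
  regroup = solveℕ-∀
  to : IsSquareℕ (n ℕ.* (v ℕ.* v)) → IsSquareℕ n
  to (k , k≢0 , nv²≡k²) = q , q≢0 , sym q²≡n
    where
    v∣k : v ∣ k
    v∣k = square-∣ v k v≢0 (divides n (sym nv²≡k²))
    q : ℕ
    q = _∣_.quotient v∣k
    k≡qv : k ≡ q ℕ.* v
    k≡qv = _∣_.equality v∣k
    q≢0 : q ≢ 0
    q≢0 q≡0 = k≢0 (trans k≡qv (cong (ℕ._* v) q≡0))
    q²≡n : q ℕ.* q ≡ n
    q²≡n = ℕP.*-cancelʳ-≡ (q ℕ.* q) n (v ℕ.* v)
      (trans (sym (regroup q v)) (trans (cong (λ t → t ℕ.* t) (sym k≡qv)) (sym nv²≡k²)))
  from : IsSquareℕ n → IsSquareℕ (n ℕ.* (v ℕ.* v))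
  from (k , k≢0 , n≡k²) = k ℕ.* v , kv≢0 , trans (cong (ℕ._* (v ℕ.* v)) n≡k²) (sym (regroup k v))
    where
    kv≢0 : k ℕ.* v ≢ 0
    kv≢0 kv≡0 with ℕP.m*n≡0⇒m≡0∨n≡0 k kv≡0
    ... | inj₁ k≡0 = k≢0 k≡0
    ... | inj₂ v≡0 = v≢0 v≡0

IsSquare-scale : ∀ Y V → V ≢ 0ℤ → IsSquare (Y * (V * V)) ⇔ IsSquare Y
IsSquare-scale Y V V≢0 = ⇔-trans (IsSquare⇔abs (Y * (V * V)))
  (⇔-trans (IsSquareℕ-cong (trans (ℤP.abs-* Y (V * V)) (cong (∣ Y ∣ ℕ.*_) (ℤP.abs-* V V))))
  (⇔-trans (IsSquareℕ-scale ∣ Y ∣ ∣ V ∣ (λ ∣V∣≡0 → V≢0 (ℤP.∣i∣≡0⇒i≡0 ∣V∣≡0)))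
           (⇔-sym (IsSquare⇔abs Y))))

-- The exponent data of the sequence.  Exponents are with respect to
-- (−1, α, α − 1, 2α − 1); hExp n for n < 8 lists h₀, …, h₇, and
-- h (8 + n) = h n · Aⁿ · B with A, B given by multA, multB.
multA multB : Exponent
multA = ⟨ 1 , 15 , 7 , 6 ⟩
multB = ⟨ 1 , 60 , 28 , 24 ⟩

hExp : ℕ → Term
hExp 0 = nothing
hExp 1 = just ⟨ 0 , 0 , 0 , 0 ⟩
hExp 2 = just ⟨ 1 , 3 , 1 , 1 ⟩
hExp 3 = just ⟨ 1 , 8 , 3 , 3 ⟩
hExp 4 = just ⟨ 0 , 14 , 6 , 6 ⟩
hExp 5 = just ⟨ 0 , 23 , 10 , 9 ⟩
hExp 6 = just ⟨ 1 , 33 , 15 , 13 ⟩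
hExp 7 = just ⟨ 1 , 45 , 21 , 18 ⟩
hExp (suc (suc (suc (suc (suc (suc (suc (suc n)))))))) = hExp n ⊗ just (n · multA ⊕ multB)

module ClosedForm (α : ℤ) where

  u v : ℤ
  u = α - + 1
  v = (+ 2) * α - + 1

  open Monomials α u v public

  c : ℕ → ℤ
  c n = ⟦ hExp n ⟧ₜ

  A B : ℤ
  A = ⟦ multA ⟧
  B = ⟦ multB ⟧

  c-shift : ∀ n → c (8 ℕ.+ n) ≡ c n * (A ^ n * B)
  c-shift n = trans (⟦⟧ₜ-⊗ (hExp n) (just (n · multA ⊕ multB)))
                    (cong (c n *_) (trans (⟦⟧-⊕ (n · multA) multB) (cong (_* B) (⟦⟧-· n multA))))

  A⁸≡B² : A ^ 8 ≡ B ^ 2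
  A⁸≡B² = trans (sym (⟦⟧-· 8 multA)) (⟦⟧-· 2 multB)

  -- The three relations behind all cancellations:
  -- α − 1 = u,  v − α = u,  α² − v = u².
  rel₁ : ⟦ x¹ ⟧ - ⟦ 𝟙 ⟧ ≡ ⟦ y¹ ⟧
  rel₁ = trans (cong (_- 1ℤ) ⟦x¹⟧) (sym ⟦y¹⟧)

  rel₂ : ⟦ z¹ ⟧ - ⟦ x¹ ⟧ ≡ ⟦ y¹ ⟧
  rel₂ = trans (cong₂ _-_ ⟦z¹⟧ ⟦x¹⟧) (trans (identity α) (sym ⟦y¹⟧))
    where
    identity : ∀ α → ((+ 2) * α - + 1) - α ≡ α - + 1
    identity = solve-∀

  rel₃ : ⟦ 2 · x¹ ⟧ - ⟦ z¹ ⟧ ≡ ⟦ 2 · y¹ ⟧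
  rel₃ = trans (cong₂ _-_ (trans (⟦⟧-sq x¹) (cong₂ _*_ ⟦x¹⟧ ⟦x¹⟧)) ⟦z¹⟧)
               (trans (identity α) (sym (trans (⟦⟧-sq y¹) (cong₂ _*_ ⟦y¹⟧ ⟦y¹⟧))))
    where
    identity : ∀ α → α * α - ((+ 2) * α - + 1) ≡ (α - + 1) * (α - + 1)
    identity = solve-∀

  OddTable : ℕ → Set
  OddTable m = ⟦ hExp (m ℕ.+ 2) ⊗ hExp m ⊗^ 3 ⟧ₜ - ⟦ hExp (m ∸ 1) ⊗ hExp (m ℕ.+ 1) ⊗^ 3 ⟧ₜ ≡ c (1 ℕ.+ m ℕ.* 2)

  EvenTable : ℕ → Set
  EvenTable m = ⟦ hExp m ⊗ (hExp (m ℕ.+ 2) ⊗ hExp (m ∸ 1) ⊗^ 2) ⟧ₜ - ⟦ hExp m ⊗ (hExp (m ∸ 2) ⊗ hExp (m ℕ.+ 1) ⊗^ 2) ⟧ₜ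
                ≡ ⟦ hExp 2 ⊗ hExp (m ℕ.* 2) ⟧ₜ

  odd-expand : ∀ m → OddTable m → OddStep c m
  odd-expand m = trans (cong₂ _-_ (⟦⟧ₜ-term (hExp (m ℕ.+ 2)) (hExp m) 3) (⟦⟧ₜ-term (hExp (m ∸ 1)) (hExp (m ℕ.+ 1)) 3))

  even-expand : ∀ m → EvenTable m → EvenStep (c 2) c m
  even-expand m table = begin
    c m * (c (m ℕ.+ 2) * c (m ∸ 1) ^ 2 - c (m ∸ 2) * c (m ℕ.+ 1) ^ 2)
      ≡⟨ cong (c m *_) (cong₂ _-_ (⟦⟧ₜ-term (hExp (m ℕ.+ 2)) (hExp (m ∸ 1)) 2) (⟦⟧ₜ-term (hExp (m ∸ 2)) (hExp (m ℕ.+ 1)) 2)) ⟩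
    c m * (⟦ P ⟧ₜ - ⟦ Q ⟧ₜ)           ≡⟨ sym (*-distribˡ-minus (c m) ⟦ P ⟧ₜ ⟦ Q ⟧ₜ) ⟩
    c m * ⟦ P ⟧ₜ - c m * ⟦ Q ⟧ₜ       ≡⟨ cong₂ _-_ (sym (⟦⟧ₜ-⊗ (hExp m) P)) (sym (⟦⟧ₜ-⊗ (hExp m) Q)) ⟩
    ⟦ hExp m ⊗ P ⟧ₜ - ⟦ hExp m ⊗ Q ⟧ₜ ≡⟨ table ⟩
    ⟦ hExp 2 ⊗ hExp (m ℕ.* 2) ⟧ₜ      ≡⟨ ⟦⟧ₜ-⊗ (hExp 2) (hExp (m ℕ.* 2)) ⟩
    c 2 * c (m ℕ.* 2)                 ∎
    where
    open ≡-Reasoning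
    P Q : Term
    P = hExp (m ℕ.+ 2) ⊗ hExp (m ∸ 1) ⊗^ 2
    Q = hExp (m ∸ 2) ⊗ hExp (m ℕ.+ 1) ⊗^ 2

  -- The sixteen base identities (m = 2, …, 9): after removing the common
  -- monomial factor each is one of rel₁, rel₂, rel₃ (possibly negated) or a
  -- difference involving the zero terms h₈ = h₁₆ = 0.
  odd-table : ∀ s → s ℕ.< 8 → OddTable (2 ℕ.+ s)
  odd-table 0 _ = ⟦⟧-factor ⟨ 1 , 23 , 9 , 9 ⟩ 𝟙 x¹ (−𝟙 ⊕ y¹) (⟦⟧-swap x¹ 𝟙 y¹ rel₁)
  odd-table 1 _ = ⟦⟧-factor ⟨ 1 , 45 , 19 , 18 ⟩ (2 · x¹) z¹ (2 · y¹) rel₃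
  odd-table 2 _ = ⟦⟧-factor ⟨ 1 , 75 , 33 , 30 ⟩ z¹ (2 · x¹) (−𝟙 ⊕ 2 · y¹) (⟦⟧-swap (2 · x¹) z¹ (2 · y¹) rel₃)
  odd-table 3 _ = ⟦⟧-factor ⟨ 1 , 113 , 51 , 45 ⟩ x¹ 𝟙 y¹ rel₁
  odd-table 4 _ = zero-minus ⟨ 3 , 158 , 73 , 63 ⟩
  odd-table 5 _ = minus-zero ⟨ 1 , 210 , 98 , 84 ⟩
  odd-table 6 _ = zero-minus ⟨ 1 , 270 , 126 , 108 ⟩
  odd-table 7 _ = minus-zero ⟨ 1 , 338 , 157 , 135 ⟩
  odd-table (suc (suc (suc (suc (suc (suc (suc (suc s)))))))) 8+s<8 = ⊥-elim (ℕP.m+n≮m 8 s 8+s<8)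

  even-table : ∀ s → s ℕ.< 8 → EvenTable (2 ℕ.+ s)
  even-table 0 _ = minus-zero ⟨ 1 , 17 , 7 , 7 ⟩
  even-table 1 _ = ⟦⟧-factor ⟨ 1 , 36 , 15 , 14 ⟩ x¹ z¹ (−𝟙 ⊕ y¹) (⟦⟧-swap z¹ x¹ y¹ rel₂)
  even-table 2 _ = self-minus ⟨ 3 , 63 , 27 , 25 ⟩
  even-table 3 _ = ⟦⟧-factor ⟨ 1 , 96 , 43 , 38 ⟩ z¹ x¹ y¹ rel₂
  even-table 4 _ = zero-minus ⟨ 3 , 137 , 63 , 55 ⟩
  even-table 5 _ = minus-zero ⟨ 1 , 186 , 86 , 74 ⟩
  even-table 6 _ = refl
  even-table 7 _ = zero-minus ⟨ 1 , 306 , 142 , 122 ⟩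
  even-table (suc (suc (suc (suc (suc (suc (suc (suc s)))))))) 8+s<8 = ⊥-elim (ℕP.m+n≮m 8 s 8+s<8)

  αξ-monomial : ∀ a b → ⟦ a · x¹ ⊕ b · (z¹ ⊕ y¹) ⟧ ≡ α ^ a * ξ α ^ b
  αξ-monomial a b = trans (⟦⟧-⊕ (a · x¹) (b · (z¹ ⊕ y¹)))
    (cong₂ _*_ (trans (⟦⟧-· a x¹) (cong (_^ a) ⟦x¹⟧))
               (trans (⟦⟧-· b (z¹ ⊕ y¹)) (cong (_^ b) (trans (⟦⟧-⊕ z¹ y¹) (cong₂ _*_ ⟦z¹⟧ ⟦y¹⟧)))))

  c₂ : c 2 ≡ h₂ α
  c₂ = trans (⟦⟧-neg (3 · x¹ ⊕ 1 · (z¹ ⊕ y¹)))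
             (cong -_ (trans (αξ-monomial 3 1) (cong (α ^ 3 *_) (ℤP.^-identityʳ (ξ α)))))

  c₃ : c 3 ≡ h₃ α
  c₃ = trans (⟦⟧-neg (8 · x¹ ⊕ 3 · (z¹ ⊕ y¹))) (cong -_ (αξ-monomial 8 3))

  c₄ : c 4 ≡ h₄ α
  c₄ = αξ-monomial 14 6

  open QuasiPeriodic 8 A B c c-shift A⁸≡B² public using (square-shift; oddStep-everywhere; evenStep-everywhere)

  c-odd : ∀ j → OddStep c (2 ℕ.+ j)
  c-odd = oddStep-everywhere (λ s s<8 → odd-expand (2 ℕ.+ s) (odd-table s s<8))

  c-even : ∀ j → EvenStep (h₂ α) c (2 ℕ.+ j)
  c-even j = trans (evenStep-everywhere (c 2) (λ s s<8 → even-expand (2 ℕ.+ s) (even-table s s<8)) j)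
                   (cong (_* c ((2 ℕ.+ j) ℕ.* 2)) c₂)

-- 2α − 1 is odd, hence never zero.
2α-1≢0 : ∀ α → (+ 2) * α - + 1 ≢ 0ℤ
2α-1≢0 α 2α-1≡0 = twice≢1 ∣ α ∣ (trans (sym (ℤP.abs-* (+ 2) α)) (cong ∣_∣ (ℤP.i-j≡0⇒i≡j ((+ 2) * α) (+ 1) 2α-1≡0)))
  where
  twice≢1 : ∀ k → 2 ℕ.* k ≢ 1
  twice≢1 zero    ()
  twice≢1 (suc k) 2k≡1 = ℕP.m+1+n≢0 k (ℕP.suc-injective 2k≡1)

module SquareClasses (α : ℤ) (α≢0 : α ≢ 0ℤ) (α≢1 : α ≢ + 1) where

  open ClosedForm α public

  monomial≢0 : ∀ e → ⟦ e ⟧ ≢ 0ℤ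
  monomial≢0 = ⟦⟧≢0 α≢0 (λ u≡0 → α≢1 (ℤP.i-j≡0⇒i≡j α (+ 1) u≡0)) (2α-1≢0 α)

  h≡c : ∀ n → h α n ≡ c n
  h≡c = h-unique α c (λ h₂≡0 → monomial≢0 ⟨ 1 , 3 , 1 , 1 ⟩ (trans c₂ h₂≡0)) refl refl c₂ c₃ c₄ c-odd c-even

  -- c (16 + n) is c n times a non-zero square.
  class-mod-16 : ∀ n → IsSquare (c n) ⇔ IsSquare (c (n % 16))
  class-mod-16 = residue-induction 16 (λ n → IsSquare (c n) ⇔ IsSquare (c (n % 16))) up base
    where
    up : ∀ i → IsSquare (c i) ⇔ IsSquare (c (i % 16)) → IsSquare (c (16 ℕ.+ i)) ⇔ IsSquare (c ((16 ℕ.+ i) % 16))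
    up i class-i = ⇔-trans (IsSquare-cong (square-shift i))
      (⇔-trans (IsSquare-scale (c i) (A ^ i * B ^ 2) (*-≢0 (^-≢0 i (monomial≢0 multA)) (^-≢0 2 (monomial≢0 multB))))
      (⇔-trans class-i (IsSquare-cong (cong c (sym (trans (cong (_% 16) (ℕP.+-comm 16 i)) (DM.[m+n]%n≡m%n i 16)))))))
    base : ∀ s → s ℕ.< 16 → IsSquare (c s) ⇔ IsSquare (c (s % 16))
    base s s<16 = IsSquare-cong (cong c (sym (DM.m<n⇒m%n≡m s<16)))

  square-class : ∀ n t e f → n % 16 ≡ t → c t ≡ ⟦ e ⊕ 2 · f ⟧ → IsSquare (h α n) ⇔ IsSquare ⟦ e ⟧
  square-class n t e f n≡t c-t = ⇔-trans (IsSquare-cong (h≡c n)) (⇔-trans (class-mod-16 n)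
    (⇔-trans (IsSquare-cong (trans (cong c n≡t) (trans c-t (⟦⟧-square e f)))) (IsSquare-scale ⟦ e ⟧ ⟦ f ⟧ (monomial≢0 f))))

  product-class : ∀ p q {a b} → ⟦ p ⟧ ≡ a → ⟦ q ⟧ ≡ b → IsSquare ⟦ p ⊕ q ⟧ ⇔ IsSquare (a * b)
  product-class p q p≡a q≡b = IsSquare-cong (trans (⟦⟧-⊕ p q) (cong₂ _*_ p≡a q≡b))

  negated-class : ∀ e {Y} → IsSquare ⟦ e ⟧ ⇔ IsSquare Y → IsSquare ⟦ −𝟙 ⊕ e ⟧ ⇔ IsSquare Y
  negated-class e class-e = ⇔-trans (IsSquare-cong (⟦⟧-neg e)) (⇔-trans (IsSquare-neg ⟦ e ⟧) class-e)

theorem5p11 : (α : ℤ) → α ≢ + 0 → α ≢ + 1 → (n : ℕ) →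
    ((n % 16 ≡ 1 ⊎ n % 16 ≡ 4 ⊎ n % 16 ≡ 12 ⊎ n % 16 ≡ 15) → IsSquare (h α n))
    × ((n % 16 ≡ 3 ⊎ n % 16 ≡ 13) → (IsSquare (h α n) ⇔ IsSquare ((α - + 1) * ((+ 2) * α - + 1))))
    × ((n % 16 ≡ 5 ⊎ n % 16 ≡ 11) → (IsSquare (h α n) ⇔ IsSquare (α * ((+ 2) * α - + 1))))
theorem5p11 α α≢0 α≢1 n = part-i , part-ii , part-iii
  where
  open SquareClasses α α≢0 α≢1
  open Equivalence using (from)
  uv-class : IsSquare ⟦ y¹ ⊕ z¹ ⟧ ⇔ IsSquare (u * v)
  uv-class = product-class y¹ z¹ ⟦y¹⟧ ⟦z¹⟧
  αv-class : IsSquare ⟦ x¹ ⊕ z¹ ⟧ ⇔ IsSquare (α * v)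
  αv-class = product-class x¹ z¹ ⟦x¹⟧ ⟦z¹⟧

  part-i : (n % 16 ≡ 1 ⊎ n % 16 ≡ 4 ⊎ n % 16 ≡ 12 ⊎ n % 16 ≡ 15) → IsSquare (h α n)
  part-i (inj₁ r)               = from (square-class n 1 𝟙 𝟙 r refl) IsSquare-one
  part-i (inj₂ (inj₁ r))        = from (square-class n 4 𝟙 ⟨ 0 , 7 , 3 , 3 ⟩ r refl) IsSquare-one
  part-i (inj₂ (inj₂ (inj₁ r))) = from (square-class n 12 −𝟙 ⟨ 0 , 67 , 31 , 27 ⟩ r refl) IsSquare-minus-one
  part-i (inj₂ (inj₂ (inj₂ r))) = from (square-class n 15 −𝟙 ⟨ 0 , 105 , 49 , 42 ⟩ r refl) IsSquare-minus-one

  part-ii : (n % 16 ≡ 3 ⊎ n % 16 ≡ 13) → IsSquare (h α n) ⇔ IsSquare (u * v)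
  part-ii (inj₁ r) = ⇔-trans (square-class n 3 (−𝟙 ⊕ (y¹ ⊕ z¹)) ⟨ 0 , 4 , 1 , 1 ⟩ r refl) (negated-class (y¹ ⊕ z¹) uv-class)
  part-ii (inj₂ r) = ⇔-trans (square-class n 13 (y¹ ⊕ z¹) ⟨ 0 , 79 , 36 , 31 ⟩ r refl) uv-class

  part-iii : (n % 16 ≡ 5 ⊎ n % 16 ≡ 11) → IsSquare (h α n) ⇔ IsSquare (α * v)
  part-iii (inj₁ r) = ⇔-trans (square-class n 5 (x¹ ⊕ z¹) ⟨ 0 , 11 , 5 , 4 ⟩ r refl) αv-class
  part-iii (inj₂ r) = ⇔-trans (square-class n 11 (−𝟙 ⊕ (x¹ ⊕ z¹)) ⟨ 0 , 56 , 26 , 22 ⟩ r refl) (negated-class (x¹ ⊕ z¹) αv-class)
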